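{- For every $n\in\omega$, ${\sf FIL}\vdash\widetilde{\mathsf R}_n$, where $\widetilde{\mathsf R}_n:=\mathsf X_n\to\mathsf Y_n\rhd\mathsf Z_n$ with $\mathsf X_0:=A_0\rhd B_0$, $\mathsf X_{n+1}:=A_{n+1}\rhd B_{n+1}\wedge\mathsf X_n$; $\mathsf Y_0:=\neg(A_0\rhd\neg C_0)$, $\mathsf Y_{n+1}:=\neg(A_{n+1}\rhd\neg C_{n+1})\wedge(E_{n+1}\rhd\mathsf Y_n)$; $\mathsf Z_0:=B_0\wedge\Box C_0$, $\mathsf Z_{n+1}:=B_{n+1}\wedge\mathsf X_n\wedge\Box C_{n+1}\wedge(E_{n+1}\rhd A_n)\wedge(E_{n+1}\rhd\mathsf Z_n)$, for arbitrary ${\sf FIL}$-formulas $A_i,B_i,C_i,E_i$.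
   Context: The logic ${\sf FIL}$: the language has propositional variables, interpretation variables $k_0,k_1,\dots$, one interpretation constant ${\sf id}$, $\top,\bot$, Boolean connectives and modalities $\Box^{\mathfrak a}A$, $A\rhd^{\mathfrak a}B$ where $\mathfrak a$ is a finite sequence of interpretation terms without repetition; unlabelled $\Box,\rhd$ stand for label ${\sf id}$ / the empty sequence; $\Diamond^{\mathfrak a}:=\neg\Box^{\mathfrak a}\neg$; $\mathfrak a,k$ is $\mathfrak a$ extended by $k$. Sequents $\Gamma\vdash C$ with $\Gamma$ a multiset, with $\Gamma,\Delta\vdash C$ iff $\Delta\vdash\bigwedge\Gamma\to C$. Axioms/rules (for all labels $\mathfrak a,\mathfrak b$, terms $k$): all tautologies; modus ponens; $\Box^{\mathfrak a}(A\to B)\to(\Box^{\mathfrak a}A\to\Box^{\mathfrak a}B)$; $\Box^{\mathfrak b}A\to\Box^{\mathfrak a}\Box^{\mathfrak b}A$; $\Box^{\mathfrak a}(\Box^{\mathfrak a}A\to A)\to\Box^{\mathfrak a}A$; $\Box^{\mathfrak a}(A\to B)\to A\rhd^{\mathfrak a}B$; $(A\rhd B)\wedge(B\rhd^{\mathfrak a}C)\to A\rhd^{\mathfrak a}C$; $(A\rhd^{\mathfrak a}B)\wedge\Box^{\mathfrak a}(B\to C)\to A\rhd^{\mathfrak a}C$; $(A\rhd^{\mathfrak a}C)\wedge(B\rhd^{\mathfrak a}C)\to A\vee B\rhd^{\mathfrak a}C$; $A\rhd^{\mathfrak a}B\to(\Diamond A\to\Diamond^{\mathfrak a}B)$; $A\rhd^{\mathfrak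 a}\Diamond^{\mathfrak b}B\to A\rhd^{\mathfrak b}B$; $\Box^{\mathfrak a,k}A\to\Box^{\mathfrak a}A$; $A\rhd^{\mathfrak a}B\to A\rhd^{\mathfrak a,k}B$; necessitation $\vdash A\Rightarrow\vdash\Box^{\mathfrak a}A$; rule $\mathsf P^{\mathfrak a,\mathfrak b,k}$: from $\Gamma,\Delta,\Box^{\mathfrak b}(A\rhd^{\mathfrak a,k}B)\vdash C$ infer $\Gamma,A\rhd^{\mathfrak a}B\vdash C$, provided $k$ is an interpretation variable not occurring in $\mathfrak a,\Gamma,A,B,C$ and $\Delta$ consists of formulas of the forms $E\rhd^{\mathfrak a,k}F\to E\rhd^{\mathfrak a}F$ and $\Box^{\mathfrak a}E\to\Box^{\mathfrak a,k}E$. ${\sf FIL}\vdash A$ means $\vdash A$ is derivable. Binding: $\neg,\Box$ strongest, Boolean connectives other than $\to$ bind stronger than $\rhd$, $\rhd$ stronger than $\to$. -}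

module Defs where

open import Data.Nat using (ℕ; zero; suc)
open import Data.Nat.Properties using () renaming (_≟_ to _≟ℕ_)
open import Data.Bool using (Bool; true; false; not; _∧_; _∨_; T; if_then_else_)
open import Data.List using (List; []; _∷_; _++_)
open import Data.List.Fresh using (List#; []; cons)
open import Data.List.Relation.Unary.All using (All)
open import Data.Product using (_×_; Σ; _,_)
open import Data.Sum using (_⊎_)
open import Data.Unit using (⊤)
open import Relation.Nullary using (¬_; Dec; yes; no)
open import Relation.Nullary.Decidable using (⌊_⌋)
open import Relation.Binary.PropositionalEquality using (_≡_)

data Term : Set where
  ivar : ℕ → Term
  idt  : Term

_==ᵗ_ : Term → Term → Bool
ivar m ==ᵗ ivar n = ⌊ m ≟ℕ n ⌋
ivar _ ==ᵗ idt    = false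
idt    ==ᵗ ivar _ = false
idt    ==ᵗ idt    = true

-- "distinct" relation (proof-irrelevant: it is T of a boolean)
_≠ᵗ_ : Term → Term → Set
s ≠ᵗ t = T (not (s ==ᵗ t))

-- Labels: finite sequences of terms without repetition.
-- Stored as a fresh list whose HEAD is the LAST element of the sequence,
-- so that the extension  𝔞,k  is  cons k 𝔞 (with proof that k ∉ 𝔞).

Label : Set
Label = List# Term _≠ᵗ_

ε : Label
ε = []

infixr 4 _⇒_
infixr 5 _∨'_
infixr 6 _∧'_
infix  7 ▷[_]
infix  8 ¬'_

data Formula : Set where
  pv   : ℕ → Formula
  ⊤'   : Formula
  ⊥'   : Formula
  ¬'_  : Formula → Formula
  _∧'_ : Formula → Formula → Formula
  _∨'_ : Formula → Formula → Formula
  _⇒_  : Formula → Formula → Formula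
  □[_] : Label → Formula → Formula
  ▷[_] : Label → Formula → Formula → Formula

◇[_] : Label → Formula → Formula
◇[ a ] A = ¬' □[ a ] (¬' A)

-- unlabelled modalities: label = empty sequence (≡ id)
□ : Formula → Formula
□ = □[ ε ]

◇ : Formula → Formula
◇ = ◇[ ε ]

infix 7 _▷_
_▷_ : Formula → Formula → Formula
A ▷ B = ▷[ ε ] A B

eval : (Formula → Bool) → Formula → Bool
eval v (pv n)       = v (pv n)
eval v ⊤'           = true
eval v ⊥'           = false
eval v (¬' A)       = not (eval v A)
eval v (A ∧' B)     = eval v A ∧ eval v B
eval v (A ∨' B)     = eval v A ∨ eval v B
eval v (A ⇒ B)      = not (eval v A) ∨ eval v B
eval v (□[ a ] A)   = v (□[ a ] A)
eval v (▷[ a ] A B) = v (▷[ a ] A B)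

Tautology : Formula → Set
Tautology A = (v : Formula → Bool) → T (eval v A)

occL : ℕ → Label → Bool
occL k []            = false
occL k (cons t a _)  = (t ==ᵗ ivar k) ∨ occL k a

occ : ℕ → Formula → Bool
occ k (pv _)       = false
occ k ⊤'           = false
occ k ⊥'           = false
occ k (¬' A)       = occ k A
occ k (A ∧' B)     = occ k A ∨ occ k B
occ k (A ∨' B)     = occ k A ∨ occ k B
occ k (A ⇒ B)      = occ k A ∨ occ k B
occ k (□[ a ] A)   = occL k a ∨ occ k A
occ k (▷[ a ] A B) = occL k a ∨ occ k A ∨ occ k B

-- conjunction of a (multiset represented as a) list of formulas
⋀ : List Formula → Formula
⋀ []       = ⊤'
⋀ (A ∷ Γ)  = A ∧' ⋀ Γ

ΔForm : (a ak : Label) → Formula → Set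
ΔForm a ak D =
  Σ Formula (λ E → Σ Formula (λ F → D ≡ (▷[ ak ] E F ⇒ ▷[ a ] E F)))
  ⊎ Σ Formula (λ E → D ≡ (□[ a ] E ⇒ □[ ak ] E))

data ⊢_ : Formula → Set

_⊩_ : List Formula → Formula → Set
Γ ⊩ C = ⊢ (⋀ Γ ⇒ C)

data ⊢_ where
  taut : ∀ {A} → Tautology A → ⊢ A
  mp   : ∀ {A B} → ⊢ (A ⇒ B) → ⊢ A → ⊢ B
  K    : ∀ a A B → ⊢ (□[ a ] (A ⇒ B) ⇒ (□[ a ] A ⇒ □[ a ] B))
  B4   : ∀ a b A → ⊢ (□[ b ] A ⇒ □[ a ] (□[ b ] A))
  L    : ∀ a A → ⊢ (□[ a ] (□[ a ] A ⇒ A) ⇒ □[ a ] A)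
  J1   : ∀ a A B → ⊢ (□[ a ] (A ⇒ B) ⇒ ▷[ a ] A B)
  J2   : ∀ a A B C → ⊢ ((A ▷ B) ∧' ▷[ a ] B C ⇒ ▷[ a ] A C)
  J2'  : ∀ a A B C → ⊢ (▷[ a ] A B ∧' □[ a ] (B ⇒ C) ⇒ ▷[ a ] A C)
  J3   : ∀ a A B C → ⊢ (▷[ a ] A C ∧' ▷[ a ] B C ⇒ ▷[ a ] (A ∨' B) C)
  J4   : ∀ a A B → ⊢ (▷[ a ] A B ⇒ (◇ A ⇒ ◇[ a ] B))
  J5   : ∀ a b A B → ⊢ (▷[ a ] A (◇[ b ] B) ⇒ ▷[ b ] A B)
  M□   : ∀ a t (p : _) A → ⊢ (□[ cons t a p ] A ⇒ □[ a ] A)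
  M▷   : ∀ a t (p : _) A B → ⊢ (▷[ a ] A B ⇒ ▷[ cons t a p ] A B)
  nec  : ∀ a {A} → ⊢ A → ⊢ (□[ a ] A)
  P    : ∀ a b k (p : _) (Γ Δ : List Formula) A B C →
         T (not (occL k a)) →
         All (λ G → T (not (occ k G))) Γ →
         T (not (occ k A)) → T (not (occ k B)) → T (not (occ k C)) →
         All (ΔForm a (cons (ivar k) a p)) Δ →
         (Γ ++ Δ ++ (□[ b ] (▷[ cons (ivar k) a p ] A B) ∷ [])) ⊩ C →
         (Γ ++ (▷[ a ] A B ∷ [])) ⊩ C

X : (ℕ → Formula) → (ℕ → Formula) → ℕ → Formula
X A B zero    = A 0 ▷ B 0
X A B (suc n) = A (suc n) ▷ (B (suc n) ∧' X A B n)

Y : (ℕ → Formula) → (ℕ → Formula) → (ℕ → Formula) → ℕ → Formula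
Y A C E zero    = ¬' (A 0 ▷ ¬' C 0)
Y A C E (suc n) = ¬' (A (suc n) ▷ ¬' C (suc n)) ∧' (E (suc n) ▷ Y A C E n)

Z : (ℕ → Formula) → (ℕ → Formula) → (ℕ → Formula) → (ℕ → Formula) → ℕ → Formula
Z A B C E zero    = B 0 ∧' □ (C 0)
Z A B C E (suc n) =
  B (suc n) ∧' X A B n ∧' □ (C (suc n)) ∧' (E (suc n) ▷ A n) ∧' (E (suc n) ▷ Z A B C E n)

R̃ : (ℕ → Formula) → (ℕ → Formula) → (ℕ → Formula) → (ℕ → Formula) → ℕ → Formula
R̃ A B C E n = X A B n ⇒ (Y A C E n ▷ Z A B C E n)

{-# OPTIONS --safe #-}
module Submission where

-- Write X n as A n ▷ B⁺ n.  By induction on n, A n ▷^c B⁺ n together with Y n yields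
-- ◇^c Z n for every label c: if □^c ¬Z n held, then inside □^c the formula B⁺ n would
-- refute □ C n, so A n ▷^c ◇ ¬C n and, by J5, A n ▷ ¬C n, contradicting Y n.  In the
-- step, the missing conjuncts E ▷ A n and E ▷ Z n of Z (n+1) follow inside □^c from
-- E ▷^κ Y n, which rule P supplies for a fresh κ.  Rule P applied to X n turns the
-- same fact into  X n ∧ F ▷^d Y n → F ▷ Z n;  for F = Y n and d = id this is R̃ n.

open import Defs
open import Data.Bool using (Bool; true; false; not; _∧_; _∨_; T)
open import Data.Bool.Properties using (T-∧; T-not-≡)
open import Data.List using (List; []; _∷_)
open import Data.List.Fresh using ([]; cons)
open import Data.List.Relation.Unary.All using (All; []; _∷_)
open import Data.Nat using (ℕ; zero; suc; _⊔_; _≤_)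
open import Data.Nat.Properties using (m⊔n≤o⇒m≤o; m⊔n≤o⇒n≤o; ≤-refl; <⇒≢) renaming (_≟_ to _≟ℕ_)
open import Data.Product using (_,_; proj₁; proj₂)
open import Data.Sum using (inj₁)
open import Data.Unit using (tt)
open import Data.Vec using (Vec; []; _∷_; map)
open import Function using (_∘_; Equivalence)
open import Relation.Nullary.Decidable using (⌊_⌋; isYes≗does; dec-false)
open import Relation.Binary.PropositionalEquality using (_≡_; refl; cong; cong₂; subst; sym; trans)

p₀ p₁ p₂ p₃ p₄ p₅ : Formula
p₀ = pv 0
p₁ = pv 1
p₂ = pv 2
p₃ = pv 3
p₄ = pv 4
p₅ = pv 5

letter : ∀ {n} {X : Set} → X → Vec X n → ℕ → X
letter d []       _       = d
letter d (x ∷ xs) zero    = x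
letter d (x ∷ xs) (suc i) = letter d xs i

letter-map : ∀ {n} {X Y : Set} (f : X → Y) d (xs : Vec X n) i →
             f (letter d xs i) ≡ letter (f d) (map f xs) i
letter-map f d []       _       = refl
letter-map f d (x ∷ xs) zero    = refl
letter-map f d (x ∷ xs) (suc i) = letter-map f d xs i

-- Instance of the schema S: pv i becomes the i-th formula of Fs.  Letters beyond Fs and
-- modal subformulas of S become ⊥', in agreement with the valuation `letters` below.
_⟨_⟩ : ∀ {n} → Formula → Vec Formula n → Formula
pv i         ⟨ Fs ⟩ = letter ⊥' Fs i
⊤'           ⟨ Fs ⟩ = ⊤'
⊥'           ⟨ Fs ⟩ = ⊥'
(¬' S)       ⟨ Fs ⟩ = ¬' (S ⟨ Fs ⟩)
(S ∧' S′)    ⟨ Fs ⟩ = S ⟨ Fs ⟩ ∧' S′ ⟨ Fs ⟩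
(S ∨' S′)    ⟨ Fs ⟩ = S ⟨ Fs ⟩ ∨' S′ ⟨ Fs ⟩
(S ⇒ S′)     ⟨ Fs ⟩ = S ⟨ Fs ⟩ ⇒ S′ ⟨ Fs ⟩
(□[ _ ] _)   ⟨ Fs ⟩ = ⊥'
(▷[ _ ] _ _) ⟨ Fs ⟩ = ⊥'

letters : ∀ {n} → Vec Bool n → Formula → Bool
letters bs (pv i) = letter false bs i
letters bs _      = false

eval-⟨⟩ : ∀ {n} v S (Fs : Vec Formula n) →
          eval v (S ⟨ Fs ⟩) ≡ eval (letters (map (eval v) Fs)) S
eval-⟨⟩ v (pv i)       Fs = letter-map (eval v) ⊥' Fs i
eval-⟨⟩ v ⊤'           Fs = refl
eval-⟨⟩ v ⊥'           Fs = refl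
eval-⟨⟩ v (¬' S)       Fs = cong not (eval-⟨⟩ v S Fs)
eval-⟨⟩ v (S ∧' S′)    Fs = cong₂ _∧_ (eval-⟨⟩ v S Fs) (eval-⟨⟩ v S′ Fs)
eval-⟨⟩ v (S ∨' S′)    Fs = cong₂ _∨_ (eval-⟨⟩ v S Fs) (eval-⟨⟩ v S′ Fs)
eval-⟨⟩ v (S ⇒ S′)     Fs = cong₂ (λ x y → not x ∨ y) (eval-⟨⟩ v S Fs) (eval-⟨⟩ v S′ Fs)
eval-⟨⟩ v (□[ _ ] _)   Fs = refl
eval-⟨⟩ v (▷[ _ ] _ _) Fs = refl

all-assignments : ∀ n → (Vec Bool n → Bool) → Bool
all-assignments zero    f = f []
all-assignments (suc n) f =
  all-assignments n (f ∘ (true ∷_)) ∧ all-assignments n (f ∘ (false ∷_))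

all-assignments-sound : ∀ n {f} → T (all-assignments n f) → ∀ bs → T (f bs)
all-assignments-sound zero    h []           = h
all-assignments-sound (suc n) h (true ∷ bs)  =
  all-assignments-sound n (proj₁ (Equivalence.to T-∧ h)) bs
all-assignments-sound (suc n) h (false ∷ bs) =
  all-assignments-sound n (proj₂ (Equivalence.to T-∧ h)) bs

tautology : ∀ {n} S (Fs : Vec Formula n) →
            {T (all-assignments n λ bs → eval (letters bs) S)} → ⊢ (S ⟨ Fs ⟩)
tautology S Fs {valid} = taut λ v →
  subst T (sym (eval-⟨⟩ v S Fs)) (all-assignments-sound _ valid (map (eval v) Fs))

infixr 3 _⨾_

_⨾_ : ∀ {A B C} → ⊢ (A ⇒ B) → ⊢ (B ⇒ C) → ⊢ (A ⇒ C)
_⨾_ {A} {B} {C} f g =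
  mp (mp (tautology ((p₀ ⇒ p₁) ⇒ (p₁ ⇒ p₂) ⇒ p₀ ⇒ p₂) (A ∷ B ∷ C ∷ [])) f) g

⇒-refl : ∀ {A} → ⊢ (A ⇒ A)
⇒-refl {A} = tautology (p₀ ⇒ p₀) (A ∷ [])

⇒-const : ∀ {H A} → ⊢ A → ⊢ (H ⇒ A)
⇒-const {H} {A} = mp (tautology (p₀ ⇒ p₁ ⇒ p₀) (A ∷ H ∷ []))

⇒-elim : ∀ {H A B} → ⊢ (H ⇒ A ⇒ B) → ⊢ (H ⇒ A) → ⊢ (H ⇒ B)
⇒-elim {H} {A} {B} f g =
  mp (mp (tautology ((p₀ ⇒ p₁ ⇒ p₂) ⇒ (p₀ ⇒ p₁) ⇒ p₀ ⇒ p₂) (H ∷ A ∷ B ∷ [])) f) g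

curry : ∀ {A B C} → ⊢ (A ∧' B ⇒ C) → ⊢ (A ⇒ B ⇒ C)
curry {A} {B} {C} = mp (tautology ((p₀ ∧' p₁ ⇒ p₂) ⇒ p₀ ⇒ p₁ ⇒ p₂) (A ∷ B ∷ C ∷ []))

contrapos : ∀ {A B} → ⊢ (A ⇒ B) → ⊢ (¬' B ⇒ ¬' A)
contrapos {A} {B} = mp (tautology ((p₀ ⇒ p₁) ⇒ ¬' p₁ ⇒ ¬' p₀) (A ∷ B ∷ []))

⟨_,_⟩ : ∀ {H A B} → ⊢ (H ⇒ A) → ⊢ (H ⇒ B) → ⊢ (H ⇒ A ∧' B)
⟨_,_⟩ {H} {A} {B} f g =
  mp (mp (tautology ((p₀ ⇒ p₁) ⇒ (p₀ ⇒ p₂) ⇒ p₀ ⇒ p₁ ∧' p₂) (H ∷ A ∷ B ∷ [])) f) g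

∧-elimˡ : ∀ {A B} → ⊢ (A ∧' B ⇒ A)
∧-elimˡ {A} {B} = tautology (p₀ ∧' p₁ ⇒ p₀) (A ∷ B ∷ [])

∧-elimʳ : ∀ {A B} → ⊢ (A ∧' B ⇒ B)
∧-elimʳ {A} {B} = tautology (p₀ ∧' p₁ ⇒ p₁) (A ∷ B ∷ [])

□-mono : ∀ a {A B} → ⊢ (A ⇒ B) → ⊢ (□[ a ] A ⇒ □[ a ] B)
□-mono a {A} {B} f = mp (K a A B) (nec a f)

□-mono₂ : ∀ a {A B C} → ⊢ (A ⇒ B ⇒ C) → ⊢ (□[ a ] A ∧' □[ a ] B ⇒ □[ a ] C)
□-mono₂ a {A} {B} {C} f =
  mp (tautology ((p₀ ⇒ p₁ ⇒ p₂) ⇒ p₀ ∧' p₁ ⇒ p₂) (□[ a ] A ∷ □[ a ] B ∷ □[ a ] C ∷ []))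
     (□-mono a f ⨾ K a B C)

▷-refl : ∀ a {A} → ⊢ ▷[ a ] A A
▷-refl a {A} = mp (J1 a A A) (nec a ⇒-refl)

¬▷⇒◇ : ∀ a {A D} → ⊢ (¬' ▷[ a ] A D ⇒ ◇[ a ] A)
¬▷⇒◇ a {A} {D} = contrapos (□-mono a (tautology (¬' p₀ ⇒ p₀ ⇒ p₁) (A ∷ D ∷ [])) ⨾ J1 a A D)

▷-◇ : ∀ c d {A B D} → ⊢ (▷[ c ] A B ∧' □[ c ] (B ⇒ ◇[ d ] D) ⇒ ▷[ d ] A D)
▷-◇ c d {A} {B} {D} = J2' c A B (◇[ d ] D) ⨾ J5 c d A D

◇-from-▷ : ∀ c {H A B C Z} →
           ⊢ (H ⇒ ▷[ c ] A B) → ⊢ (H ⇒ ¬' (A ▷ ¬' C)) → ⊢ (H ⇒ □[ c ] (B ⇒ □ C ⇒ Z)) →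
           ⊢ (H ⇒ ◇[ c ] Z)
◇-from-▷ c {H} {A} {B} {C} {Z} H⇒A▷B H⇒¬A▷¬C H⇒□ =
  mp (mp (tautology ((p₀ ∧' p₁ ⇒ p₂) ⇒ (p₀ ⇒ ¬' p₂) ⇒ p₀ ⇒ ¬' p₁)
                    (H ∷ □[ c ] (¬' Z) ∷ A ▷ ¬' C ∷ []))
         (⟨ ∧-elimˡ ⨾ H⇒A▷B , ⟨ ∧-elimˡ ⨾ H⇒□ , ∧-elimʳ ⟩ ⨾ □-mono₂ c B⇒◇¬C ⟩ ⨾ ▷-◇ c ε))
     H⇒¬A▷¬C
  where
  B⇒◇¬C : ⊢ ((B ⇒ □ C ⇒ Z) ⇒ ¬' Z ⇒ B ⇒ ◇ (¬' C))
  B⇒◇¬C = mp (tautology ((p₃ ⇒ p₁) ⇒ (p₀ ⇒ p₁ ⇒ p₂) ⇒ ¬' p₂ ⇒ p₀ ⇒ ¬' p₃)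
                        (B ∷ □ C ∷ Z ∷ □ (¬' ¬' C) ∷ []))
             (□-mono ε (tautology (¬' ¬' p₀ ⇒ p₀) (C ∷ [])))

boundˡ : Label → ℕ
boundˡ []                  = 0
boundˡ (cons (ivar m) a _) = suc m ⊔ boundˡ a
boundˡ (cons idt a _)      = boundˡ a

bound : Formula → ℕ
bound (pv _)       = 0
bound ⊤'           = 0
bound ⊥'           = 0
bound (¬' A)       = bound A
bound (A ∧' B)     = bound A ⊔ bound B
bound (A ∨' B)     = bound A ⊔ bound B
bound (A ⇒ B)      = bound A ⊔ bound B
bound (□[ a ] A)   = boundˡ a ⊔ bound A
bound (▷[ a ] A B) = boundˡ a ⊔ (bound A ⊔ bound B)

∨-false-⊔ : ∀ m n {k x y} → (m ≤ k → x ≡ false) → (n ≤ k → y ≡ false) →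
            m ⊔ n ≤ k → x ∨ y ≡ false
∨-false-⊔ m n f g m⊔n≤k = cong₂ _∨_ (f (m⊔n≤o⇒m≤o m n m⊔n≤k)) (g (m⊔n≤o⇒n≤o m n m⊔n≤k))

occL-≥ : ∀ a {k} → boundˡ a ≤ k → occL k a ≡ false
occL-≥ []                  _ = refl
occL-≥ (cons (ivar m) a _) {k} = ∨-false-⊔ (suc m) (boundˡ a) m≢k (occL-≥ a)
  where
  m≢k : suc m ≤ k → ⌊ m ≟ℕ k ⌋ ≡ false
  m≢k m<k = trans (isYes≗does (m ≟ℕ k)) (dec-false (m ≟ℕ k) (<⇒≢ m<k))
occL-≥ (cons idt a _)      = occL-≥ a

occ-≥ : ∀ F {k} → bound F ≤ k → occ k F ≡ false
occ-≥ (pv _)       _ = refl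
occ-≥ ⊤'           _ = refl
occ-≥ ⊥'           _ = refl
occ-≥ (¬' A)         = occ-≥ A
occ-≥ (A ∧' B)       = ∨-false-⊔ (bound A) (bound B) (occ-≥ A) (occ-≥ B)
occ-≥ (A ∨' B)       = ∨-false-⊔ (bound A) (bound B) (occ-≥ A) (occ-≥ B)
occ-≥ (A ⇒ B)        = ∨-false-⊔ (bound A) (bound B) (occ-≥ A) (occ-≥ B)
occ-≥ (□[ a ] A)     = ∨-false-⊔ (boundˡ a) (bound A) (occL-≥ a) (occ-≥ A)
occ-≥ (▷[ a ] A B)   = ∨-false-⊔ (boundˡ a) (bound A ⊔ bound B) (occL-≥ a)
                         (∨-false-⊔ (bound A) (bound B) (occ-≥ A) (occ-≥ B))

fresh : List Formula → ℕ
fresh Γ = bound (⋀ Γ)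

fresh-∉ : ∀ Γ {k} → fresh Γ ≤ k → All (λ F → T (not (occ k F))) Γ
fresh-∉ []      _ = []
fresh-∉ (F ∷ Γ) Γ≤k =
  Equivalence.from T-not-≡ (occ-≥ F (m⊔n≤o⇒m≤o (bound F) (fresh Γ) Γ≤k))
  ∷ fresh-∉ Γ (m⊔n≤o⇒n≤o (bound F) (fresh Γ) Γ≤k)

P-▷ : ∀ b {G A B C} E F →
      (∀ κ → ⊢ (G ∧' (▷[ κ ] E F ⇒ E ▷ F) ∧' □[ b ] (▷[ κ ] A B) ⇒ C)) →
      ⊢ (G ∧' A ▷ B ⇒ C)
P-▷ b {G} {A} {B} {C} E F premise with fresh-∉ (G ∷ A ∷ B ∷ C ∷ []) ≤-refl
... | G∌k ∷ A∌k ∷ B∌k ∷ C∌k ∷ [] =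
  tautology (p₀ ∧' p₁ ⇒ p₀ ∧' p₁ ∧' ⊤') (G ∷ A ▷ B ∷ [])
  ⨾ P ε b k _ (G ∷ []) (▷κ⇒▷ ∷ []) A B C tt (G∌k ∷ []) A∌k B∌k C∌k (inj₁ (E , F , refl) ∷ [])
      (tautology (p₀ ∧' p₁ ∧' p₂ ∧' ⊤' ⇒ p₀ ∧' p₁ ∧' p₂) (G ∷ ▷κ⇒▷ ∷ □[ b ] (▷[ κ ] A B) ∷ [])
       ⨾ premise κ)
  where
  k : ℕ
  k = fresh (G ∷ A ∷ B ∷ C ∷ [])
  κ : Label
  κ = cons (ivar k) ε _
  ▷κ⇒▷ : Formula
  ▷κ⇒▷ = ▷[ κ ] E F ⇒ E ▷ F

P-□ : ∀ b {G A B C} → (∀ κ → ⊢ (G ∧' □[ b ] (▷[ κ ] A B) ⇒ C)) → ⊢ (G ∧' A ▷ B ⇒ C)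
P-□ b {G} {A} {B} premise = P-▷ b ⊤' ⊤' λ κ →
  tautology (p₀ ∧' p₁ ∧' p₂ ⇒ p₀ ∧' p₂) (G ∷ (▷[ κ ] ⊤' ⊤' ⇒ ⊤' ▷ ⊤') ∷ □[ b ] (▷[ κ ] A B) ∷ [])
  ⨾ premise κ

Forces : Formula → Formula → Formula → Formula → Set
Forces A B Y Z = ∀ c → ⊢ (▷[ c ] A B ∧' Y ⇒ ◇[ c ] Z)

forces-base : ∀ A B C → Forces A B (¬' (A ▷ ¬' C)) (B ∧' □ C)
forces-base A B C c =
  ◇-from-▷ c ∧-elimˡ ∧-elimʳ (⇒-const (nec c (tautology (p₀ ⇒ p₁ ⇒ p₀ ∧' p₁) (B ∷ □ C ∷ []))))

-- Under □^d the instance A ▷^κ B turns Y into ◇^κ Z, so F ▷^d Y becomes F ▷^κ Z,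
-- which the Δ-formula of rule P brings back to F ▷ Z.
forces-▷ : ∀ {A B Y Z} → Forces A B Y Z → ∀ d F → ⊢ (▷[ d ] F Y ∧' A ▷ B ⇒ F ▷ Z)
forces-▷ {A} {B} {Y} {Z} forces d F = P-▷ d F Z λ κ →
  ⇒-elim (∧-elimʳ ⨾ ∧-elimˡ)
         (⟨ ∧-elimˡ , ∧-elimʳ ⨾ ∧-elimʳ ⨾ □-mono d (curry (forces κ)) ⟩ ⨾ ▷-◇ d κ)

forces-step : ∀ {A B C E X Y Z A′} →
              (∀ κ → ⊢ (▷[ κ ] E Y ∧' X ⇒ E ▷ Z)) → ⊢ (Y ⇒ ◇ A′) →
              Forces A (B ∧' X) (¬' (A ▷ ¬' C) ∧' E ▷ Y) (B ∧' X ∧' □ C ∧' E ▷ A′ ∧' E ▷ Z)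
forces-step {A} {B} {C} {E} {X} {Y} {Z} {A′} transfer Y⇒◇A′ c =
  tautology (p₀ ∧' p₁ ∧' p₂ ⇒ (p₀ ∧' p₁) ∧' p₂) (▷[ c ] A (B ∧' X) ∷ ¬' (A ▷ ¬' C) ∷ E ▷ Y ∷ [])
  ⨾ P-□ c λ κ →
      ◇-from-▷ c (∧-elimˡ ⨾ ∧-elimˡ) (∧-elimˡ ⨾ ∧-elimʳ) (∧-elimʳ ⨾ □-mono c (completes κ))
  where
  reaches-A′ : ∀ κ → ⊢ (▷[ κ ] E Y ⇒ E ▷ A′)
  reaches-A′ κ = ⟨ ⇒-refl , ⇒-const (nec κ Y⇒◇A′) ⟩ ⨾ ▷-◇ κ ε

  completes : ∀ κ → ⊢ (▷[ κ ] E Y ⇒ B ∧' X ⇒ □ C ⇒ B ∧' X ∧' □ C ∧' E ▷ A′ ∧' E ▷ Z)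
  completes κ =
    mp (mp (tautology ((p₀ ⇒ p₁) ⇒ (p₀ ∧' p₂ ⇒ p₃) ⇒ p₀ ⇒ p₄ ∧' p₂ ⇒ p₅ ⇒ p₄ ∧' p₂ ∧' p₅ ∧' p₁ ∧' p₃)
                      (▷[ κ ] E Y ∷ E ▷ A′ ∷ X ∷ E ▷ Z ∷ B ∷ □ C ∷ []))
           (reaches-A′ κ))
       (transfer κ)

module _ (A B C E : ℕ → Formula) where

  B⁺ : ℕ → Formula
  B⁺ zero    = B zero
  B⁺ (suc n) = B (suc n) ∧' X A B n

  Y⇒◇A : ∀ n → ⊢ (Y A C E n ⇒ ◇ (A n))
  Y⇒◇A zero    = ¬▷⇒◇ ε
  Y⇒◇A (suc n) = ∧-elimˡ ⨾ ¬▷⇒◇ ε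

  mutual
    forces : ∀ n → Forces (A n) (B⁺ n) (Y A C E n) (Z A B C E n)
    forces zero    = forces-base (A zero) (B zero) (C zero)
    forces (suc n) = forces-step (λ κ → transfer n κ (E (suc n))) (Y⇒◇A n)

    -- The split on n is what lets X A B n reduce to A n ▷ B⁺ n.
    transfer : ∀ n d F → ⊢ (▷[ d ] F (Y A C E n) ∧' X A B n ⇒ F ▷ Z A B C E n)
    transfer zero    = forces-▷ (forces zero)
    transfer (suc n) = forces-▷ (forces (suc n))

mainTheorem2 : (A B C E : ℕ → Formula) (n : ℕ) → ⊢ R̃ A B C E n
mainTheorem2 A B C E n = mp (curry (transfer A B C E n ε (Y A C E n))) (▷-refl ε)
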